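{- Let $k\ge 1$ be a fixed integer. Then, as $n\to\infty$, $\operatorname{tw}(F_k(S_n)) \in \Theta(n^{k-1})$, where $S_n$ is the star with center $0$ and leaves $1,\dots,n$.
   Context: For a graph $G$ and integer $k$, the $k$-token graph $F_k(G)$ has as vertices the $k$-element subsets of $V(G)$, two being adjacent when their symmetric difference is an edge of $G$. $\operatorname{tw}$ denotes treewidth (minimum over tree decompositions of the maximum bag size minus one). The star $S_n=K_{1,n}$ has vertex set $\{0\}\cup[n]$ with center $0$. -}

module Defs where

open import Data.Nat using (ℕ; zero; suc; _≤_; _∸_; _*_; _^_)
open import Data.Fin using (Fin; toℕ) renaming (zero to fz; suc to fs)
open import Data.Fin.Subset as S using (Subset; ∣_∣)
open import Data.List using (List; length)
open import Data.List.Membership.Propositional using (_∈_)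
open import Data.List.Relation.Unary.Unique.Propositional using (Unique)
open import Data.Product using (Σ; ∃; _×_; _,_)
open import Data.Sum using (_⊎_)
open import Relation.Binary.PropositionalEquality using (_≡_; _≢_)
open import Relation.Nullary using (¬_)
open import Function.Bundles using (_⇔_)

StarEdge : (n : ℕ) → Fin (suc n) → Fin (suc n) → Set
StarEdge n u v = (u ≡ fz × v ≢ fz) ⊎ (v ≡ fz × u ≢ fz)

-- k-token graph F_k(S_n): vertices are k-element subsets of V(S_n);
-- A ~ B iff the symmetric difference A △ B is exactly {u, v} for an
-- edge uv of S_n.

TokenV : (n k : ℕ) → Set
TokenV n k = Σ (Subset (suc n)) (λ A → ∣ A ∣ ≡ k)

TokenAdj : (n k : ℕ) → TokenV n k → TokenV n k → Set
TokenAdj n k (A , _) (B , _) =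
  ∃ λ u → ∃ λ v → StarEdge n u v
    × (u S.∈ A) × (u S.∉ B) × (v S.∈ B) × (v S.∉ A)
    × (∀ w → w ≢ u → w ≢ v → (w S.∈ A ⇔ w S.∈ B))

-- Trees: a finite tree with node set Fin (suc t), rooted at node 0,
-- given by a parent pointer: node (fs i) has parent (parent i) whose
-- index is ≤ i (so strictly smaller than fs i).  Every finite
-- nonempty tree admits such a labelling (e.g. BFS order).

module _ {t : ℕ} (parent : Fin t → Fin (suc t)) where

  TreeAdj : Fin (suc t) → Fin (suc t) → Set
  TreeAdj x y = (∃ λ i → x ≡ fs i × y ≡ parent i)
              ⊎ (∃ λ i → y ≡ fs i × x ≡ parent i)

  data WalkIn (P : Fin (suc t) → Set) : Fin (suc t) → Fin (suc t) → Set where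
    here : ∀ {x} → P x → WalkIn P x x
    step : ∀ {x y z} → P x → TreeAdj x y → WalkIn P y z → WalkIn P x z

record TreeDecomposition {V : Set} (E : V → V → Set) : Set where
  field
    t          : ℕ
    parent     : Fin t → Fin (suc t)
    parent<    : ∀ i → toℕ (parent i) ≤ toℕ i
    bag        : Fin (suc t) → List V
    bagUnique  : ∀ x → Unique (bag x)
    vertCover  : ∀ v → ∃ λ x → v ∈ bag x
    edgeCover  : ∀ u v → E u v → ∃ λ x → u ∈ bag x × v ∈ bag x
    subtreeConn : ∀ v x y → v ∈ bag x → v ∈ bag y →
                  WalkIn parent (λ z → v ∈ bag z) x y

open TreeDecomposition public

WidthAtMost : {V : Set} {E : V → V → Set} → TreeDecomposition E → ℕ → Set
WidthAtMost D w = ∀ x → length (bag D x) ≤ suc w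

TwAtMost : {V : Set} (E : V → V → Set) → ℕ → Set
TwAtMost E w = Σ (TreeDecomposition E) (λ D → WidthAtMost D w)

WidthBoundsBelow : {V : Set} {E : V → V → Set} → TreeDecomposition E → ℕ → ℕ → Set
WidthBoundsBelow D c m = ∃ λ x → m ≤ c * (length (bag D x) ∸ 1)

TwBoundsBelow : {V : Set} (E : V → V → Set) → ℕ → ℕ → Set
TwBoundsBelow E c m = ∀ (D : TreeDecomposition E) → WidthBoundsBelow D c m

module Submission where

-- Upper bound: every edge of F_k(S_n) moves a token to or from the centre, so the k-sets
-- containing the centre, at most n^(k-1) of them, form a bag next to which every other
-- k-set can be hung as a leaf bag of a star-shaped tree.
--
-- Lower bound for k = d + 1 ≥ 2: split about d m leaves into d blocks of m. Each grid point
-- g ∈ [m]^d gives the k-set X g made of the centre and leaf g j of every block j, and any two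
-- of these q = m^d sets are joined by a route of 2d + 1 vertices that changes one coordinate
-- at a time. In a tree decomposition, attach each X g to a bag containing it and let x be the
-- deepest node whose subtree carries more than half of them; every component of the tree
-- minus x carries at most half, so for each g at least half of the routes from X g meet the
-- bag of x. As a vertex at a given position lies on at most q routes, that bag has at least
-- q / (2(2d + 1)) vertices, which is of order n^d. For k = 1 the token graph is the star
-- itself, and any edge forces a bag of two vertices.

open import Defs
open import Data.Bool using (Bool; true; false; not; _∧_; _∨_; if_then_else_)
import Data.Bool
open import Data.Empty using (⊥-elim)
open import Data.Fin using (Fin; toℕ; combine; remQuot; _↑ˡ_; _↑ʳ_; splitAt; join; fromℕ<; punchOut; funToFin; finToFun)
  renaming (zero to fz; suc to fs)
import Data.Fin.Properties as Fin
open import Data.Fin.Subset as S using (Subset; ∣_∣)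
open import Data.Fin.Subset.Properties using (∣⊥∣≡0)
open import Data.List using (List; []; _∷_; length; map; _++_)
import Data.List as List
open import Data.List.Membership.Propositional using (_∈_)
open import Data.List.Membership.Propositional.Properties using (∈-map⁺; ∈-map⁻; ∈-++⁺ˡ; ∈-++⁺ʳ; ∈-++⁻; ∈-lookup)
open import Data.List.Properties using (length-map; length-++)
open import Data.List.Relation.Unary.All as All using ([])
open import Data.List.Relation.Unary.Any using (here; index)
open import Data.List.Relation.Unary.Any.Properties using (lookup-index)
open import Data.List.Relation.Unary.Unique.Propositional using (Unique; []; _∷_)
import Data.List.Relation.Unary.Unique.Propositional.Properties as Unique
open import Data.Maybe using (Maybe; just; nothing)
import Data.Maybe.Properties as Maybe
open import Data.Nat using (ℕ; zero; suc; _≤_; _<_; _*_; _+_; _∸_; _^_; z≤n; s≤s; s≤s⁻¹; NonZero; >-nonZero⁻¹; _<?_; _≤?_)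
open import Data.Nat.DivMod using (_/_; _%_; m≡m%n+[m/n]*n; m%n<n; /-monoˡ-≤; m*n/n≡m)
open import Data.Nat.Properties
open import Algebra.Properties.Semiring.Sum +-*-semiring
  using (sum; sum-syntax; ∑-distrib-+; sum-cong-≗; *-distribˡ-sum)
open import Data.Nat.Solver using (module +-*-Solver)
open import Data.Product using (Σ; ∃; _×_; _,_; proj₁; proj₂)
open import Data.Sum using (_⊎_; inj₁; inj₂)
open import Data.Vec using ([]; _∷_; head; here; concat; tabulate; replicate; lookup) renaming (_++_ to _++ᵛ_)
import Data.Vec.Properties as Vec
open import Function using (_∘_)
open import Function.Bundles using (mk⇔)
open import Relation.Binary.Definitions using (DecidableEquality)
open import Relation.Binary.PropositionalEquality hiding ([_])
open import Relation.Nullary using (¬_; Dec; yes; no; does; _×-dec_)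
open import Relation.Unary using (Decidable)

-- Finite sums and counting

∑-mono-≤ : ∀ {n} {f g : Fin n → ℕ} → (∀ i → f i ≤ g i) → sum f ≤ sum g
∑-mono-≤ {zero} f≤g = z≤n
∑-mono-≤ {suc n} f≤g = +-mono-≤ (f≤g fz) (∑-mono-≤ (f≤g ∘ fs))

∑-const : ∀ n c → ∑[ i < n ] c ≡ n * c
∑-const zero c = refl
∑-const (suc n) c = cong (c +_) (∑-const n c)

∑-↑ : ∀ a b (f : Fin (a + b) → ℕ) → sum f ≡ ∑[ i < a ] f (i ↑ˡ b) + ∑[ j < b ] f (a ↑ʳ j)
∑-↑ zero b f = refl
∑-↑ (suc a) b f = trans (cong (f fz +_) (∑-↑ a b (f ∘ fs))) (sym (+-assoc (f fz) _ _))

∑-combine : ∀ a b (f : Fin (a * b) → ℕ) → sum f ≡ ∑[ i < a ] ∑[ j < b ] f (combine i j)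
∑-combine zero b f = refl
∑-combine (suc a) b f =
  trans (∑-↑ b (a * b) f) (cong (∑[ j < b ] f (j ↑ˡ (a * b)) +_) (∑-combine a b (f ∘ (b ↑ʳ_))))

indicator : Bool → ℕ
indicator true = 1
indicator false = 0

count : ∀ {n} → (Fin n → Bool) → ℕ
count f = ∑[ i < _ ] indicator (f i)

count-mono : ∀ {n} (f g : Fin n → Bool) → (∀ i → f i ≡ true → g i ≡ true) → count f ≤ count g
count-mono f g f⊆g = ∑-mono-≤ (λ i → indicator-mono (f i) (g i) (f⊆g i))
  where
  indicator-mono : ∀ a b → (a ≡ true → b ≡ true) → indicator a ≤ indicator b
  indicator-mono false b _ = z≤n
  indicator-mono true b a⇒b rewrite a⇒b refl = ≤-refl

count-none : ∀ {n} (f : Fin n → Bool) → (∀ i → f i ≡ false) → count f ≡ 0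
count-none {zero} f none = refl
count-none {suc n} f none rewrite none fz = count-none (f ∘ fs) (none ∘ fs)

count-all : ∀ {n} (f : Fin n → Bool) → (∀ i → f i ≡ true) → count f ≡ n
count-all {n} f all = trans (sum-cong-≗ (λ i → cong indicator (all i))) (trans (∑-const n 1) (*-identityʳ n))

count-+-count-not : ∀ {n} (f : Fin n → Bool) → count f + count (not ∘ f) ≡ n
count-+-count-not {n} f = trans (sym (∑-distrib-+ (indicator ∘ f) (indicator ∘ not ∘ f)))
  (trans (sum-cong-≗ (λ i → indicator-not (f i))) (trans (∑-const n 1) (*-identityʳ n)))
  where
  indicator-not : ∀ b → indicator b + indicator (not b) ≡ 1
  indicator-not true = refl
  indicator-not false = refl

_==_ : ∀ {n} → Fin n → Fin n → Bool
x == y = does (x Fin.≟ y)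

count-== : ∀ {n} (x : Fin n) → count (x ==_) ≡ 1
count-== {suc n} fz = cong suc (count-none {n} (λ i → fz == fs i) (λ _ → refl))
count-== {suc n} (fs x) = trans (sum-cong-≗ ==-fs) (count-== x)
  where
  ==-fs : ∀ y → indicator (fs x == fs y) ≡ indicator (x == y)
  ==-fs y with x Fin.≟ y
  ... | yes _ = refl
  ... | no _ = refl

count-≤-injective : ∀ {n b} (f : Fin n → Bool) (g : ∀ i → f i ≡ true → Fin b) →
  (∀ i j fi fj → g i fi ≡ g j fj → i ≡ j) → count f ≤ b
count-≤-injective {zero} f g g-inj = z≤n
count-≤-injective {suc n} {b} f g g-inj with f fz in f0
... | false = count-≤-injective (f ∘ fs) (g ∘ fs) (λ i j fi fj → Fin.suc-injective ∘ g-inj (fs i) (fs j) fi fj)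
count-≤-injective {suc n} {suc b} f g g-inj | true =
  s≤s (count-≤-injective (f ∘ fs) g′ g′-inj)
  where
  g₀≢ : ∀ i fi → g fz f0 ≢ g (fs i) fi
  g₀≢ i fi e with g-inj fz (fs i) f0 fi e
  ... | ()
  g′ : ∀ i → f (fs i) ≡ true → Fin b
  g′ i fi = punchOut (g₀≢ i fi)
  g′-inj : ∀ i j fi fj → g′ i fi ≡ g′ j fj → i ≡ j
  g′-inj i j fi fj e = Fin.suc-injective (g-inj (fs i) (fs j) fi fj (Fin.punchOut-injective (g₀≢ i fi) (g₀≢ j fj) e))
count-≤-injective {suc n} {zero} f g g-inj | true with g fz f0
... | ()

==-refl : ∀ {n} (x : Fin n) → x == x ≡ true
==-refl x with x Fin.≟ x
... | yes _ = refl
... | no x≢x = ⊥-elim (x≢x refl)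

==-sound : ∀ {n} {x y : Fin n} → x == y ≡ true → x ≡ y
==-sound {x = x} {y} t with x Fin.≟ y
... | yes x≡y = x≡y

==-false : ∀ {n} {x y : Fin n} → x ≢ y → x == y ≡ false
==-false {x = x} {y} x≢y with x Fin.≟ y
... | yes x≡y = ⊥-elim (x≢y x≡y)
... | no _ = refl

∣tabulate∣ : ∀ {n} (f : Fin n → Bool) → ∣ tabulate f ∣ ≡ count f
∣tabulate∣ {zero} f = refl
∣tabulate∣ {suc n} f with f fz
... | true = cong suc (∣tabulate∣ (f ∘ fs))
... | false = ∣tabulate∣ (f ∘ fs)

∣++∣ : ∀ {a b} (xs : Subset a) (ys : Subset b) → ∣ xs ++ᵛ ys ∣ ≡ ∣ xs ∣ + ∣ ys ∣
∣++∣ [] ys = refl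
∣++∣ (true ∷ xs) ys = cong suc (∣++∣ xs ys)
∣++∣ (false ∷ xs) ys = ∣++∣ xs ys

∣concat∣ : ∀ {a b} (xss : Fin a → Subset b) → ∣ concat (tabulate xss) ∣ ≡ ∑[ i < a ] ∣ xss i ∣
∣concat∣ {zero} xss = refl
∣concat∣ {suc a} xss = trans (∣++∣ (xss fz) _) (cong (∣ xss fz ∣ +_) (∣concat∣ (xss ∘ fs)))

-- Routes through a tree decomposition

data PathIn {V : Set} (E : V → V → Set) (P : V → Set) : V → V → Set where
  [_] : ∀ {x} → P x → PathIn E P x x
  step : ∀ {x y z} → P x → E x y → PathIn E P y z → PathIn E P x z

module _ {V : Set} {E : V → V → Set} where

  _++ᵖ_ : ∀ {P x y z} → PathIn E P x y → PathIn E P y z → PathIn E P x z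
  [ _ ] ++ᵖ π = π
  step p e π ++ᵖ π′ = step p e (π ++ᵖ π′)

  PathIn-map : ∀ {P R : V → Set} → (∀ {v} → P v → R v) → ∀ {x y} → PathIn E P x y → PathIn E R x y
  PathIn-map f [ p ] = [ f p ]
  PathIn-map f (step p e π) = step (f p) e (PathIn-map f π)

  PathIn-head : ∀ {P x y} → PathIn E P x y → P x
  PathIn-head [ p ] = p
  PathIn-head (step p _ _) = p

  PathIn-last : ∀ {P x y} → PathIn E P x y → P y
  PathIn-last [ p ] = p
  PathIn-last (step _ _ π) = PathIn-last π

does-true : ∀ {P : Set} (P? : Dec P) → does P? ≡ true → P
does-true (yes p) _ = p

maximal-satisfying : ∀ {t} {P : Fin (suc t) → Set} → Decidable P → ∀ {x} → P x →
  ∃ λ z → P z × (∀ y → toℕ z < toℕ y → ¬ P y)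
maximal-satisfying {t} {P} P? {x} Px = search t x Px (m≤m+n t (toℕ x))
  where
  search : ∀ gap x → P x → t ≤ gap + toℕ x → ∃ λ z → P z × (∀ y → toℕ z < toℕ y → ¬ P y)
  search gap x Px t≤ with Fin.any? (λ y → (toℕ x <? toℕ y) ×-dec P? y)
  ... | no none = x , Px , λ y x<y Py → none (y , x<y , Py)
  search zero x Px t≤ | yes (y , x<y , Py) = ⊥-elim (<-irrefl refl (≤-trans x<y (≤-trans (Fin.toℕ≤pred[n] y) t≤)))
  search (suc gap) x Px t≤ | yes (y , x<y , Py) =
    search gap y Py (≤-trans t≤ (≤-trans (≤-reflexive (sym (+-suc gap (toℕ x)))) (+-monoʳ-≤ gap x<y)))

module Rooted {t : ℕ} (parent : Fin t → Fin (suc t)) (parent< : ∀ i → toℕ (parent i) ≤ toℕ i) where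

  Node : Set
  Node = Fin (suc t)

  private
    parent-fuel : ∀ {f} i → suc (toℕ i) < suc f → toℕ (parent i) < f
    parent-fuel i (s≤s i<f) = <-≤-trans (s≤s (parent< i)) i<f

  -- Walking up from a to the root takes at most toℕ a steps, so suc (toℕ a) is enough fuel.
  inSubtreeFuel : ℕ → Node → Node → Bool
  inSubtreeFuel zero y a = false
  inSubtreeFuel (suc f) y a with a Fin.≟ y
  ... | yes _ = true
  inSubtreeFuel (suc f) y fz | no _ = false
  inSubtreeFuel (suc f) y (fs i) | no _ = inSubtreeFuel f y (parent i)

  inSubtree : Node → Node → Bool
  inSubtree y a = inSubtreeFuel (suc (toℕ a)) y a

  inSubtreeFuel-enough : ∀ f f′ y a → toℕ a < f → toℕ a < f′ → inSubtreeFuel f y a ≡ inSubtreeFuel f′ y a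
  inSubtreeFuel-enough (suc f) (suc f′) y a a<f a<f′ with a Fin.≟ y
  ... | yes _ = refl
  inSubtreeFuel-enough (suc f) (suc f′) y fz a<f a<f′ | no _ = refl
  inSubtreeFuel-enough (suc f) (suc f′) y (fs i) a<f a<f′ | no _ =
    inSubtreeFuel-enough f f′ y (parent i) (parent-fuel i a<f) (parent-fuel i a<f′)

  inSubtree-parent : ∀ y i → inSubtreeFuel (suc (toℕ i)) y (parent i) ≡ inSubtree y (parent i)
  inSubtree-parent y i = inSubtreeFuel-enough (suc (toℕ i)) (suc (toℕ (parent i))) y (parent i) (s≤s (parent< i)) ≤-refl

  inSubtree-refl : ∀ a → inSubtree a a ≡ true
  inSubtree-refl a with a Fin.≟ a
  ... | yes _ = refl
  ... | no a≢a = ⊥-elim (a≢a refl)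

  inSubtree-root : ∀ a → inSubtree fz a ≡ true
  inSubtree-root a = go (suc (toℕ a)) a ≤-refl
    where
    go : ∀ f a → toℕ a < f → inSubtreeFuel f fz a ≡ true
    go (suc f) a a<f with a Fin.≟ fz
    ... | yes _ = refl
    go (suc f) fz a<f | no a≢0 = ⊥-elim (a≢0 refl)
    go (suc f) (fs i) a<f | no _ = go f (parent i) (parent-fuel i a<f)

  -- towards x a is the child of x whose subtree contains a, or nothing if a is not a proper
  -- descendant of x; the components of the tree minus x are exactly its fibres.
  module Towards (x : Node) where

    towardsFuel : ℕ → Node → Maybe Node
    towardsFuel zero a = nothing
    towardsFuel (suc f) fz = nothing
    towardsFuel (suc f) (fs i) with parent i Fin.≟ x
    ... | yes _ = just (fs i)
    ... | no _ = towardsFuel f (parent i)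

    towards : Node → Maybe Node
    towards a = towardsFuel (suc (toℕ a)) a

    towardsFuel-enough : ∀ f f′ a → toℕ a < f → toℕ a < f′ → towardsFuel f a ≡ towardsFuel f′ a
    towardsFuel-enough (suc f) (suc f′) fz a<f a<f′ = refl
    towardsFuel-enough (suc f) (suc f′) (fs i) a<f a<f′ with parent i Fin.≟ x
    ... | yes _ = refl
    ... | no _ = towardsFuel-enough f f′ (parent i) (parent-fuel i a<f) (parent-fuel i a<f′)

    towards-step : ∀ i → parent i ≢ x → towards (fs i) ≡ towards (parent i)
    towards-step i p≢x with parent i Fin.≟ x
    ... | yes p≡x = ⊥-elim (p≢x p≡x)
    ... | no _ = towardsFuel-enough (suc (toℕ i)) (suc (toℕ (parent i))) (parent i) (s≤s (parent< i)) ≤-refl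

    towards-just : ∀ a c → towards a ≡ just c → inSubtree c a ≡ true × toℕ x < toℕ c
    towards-just a c = go (suc (toℕ a)) a ≤-refl
      where
      go : ∀ f a → toℕ a < f → towardsFuel f a ≡ just c → inSubtree c a ≡ true × toℕ x < toℕ c
      go (suc f) (fs i) a<f eq with parent i Fin.≟ x
      go (suc f) (fs i) a<f refl | yes p≡x =
        inSubtree-refl (fs i) , subst (λ w → toℕ w < suc (toℕ i)) p≡x (s≤s (parent< i))
      ... | no _ with go f (parent i) (parent-fuel i a<f) eq
      ... | c∋p , x<c = c∋a , x<c
        where
        c∋a : inSubtree c (fs i) ≡ true
        c∋a with fs i Fin.≟ c
        ... | yes _ = refl
        ... | no _ = trans (inSubtree-parent c i) c∋p

    towards-nothing : ∀ a → a ≢ x → towards a ≡ nothing → inSubtree x a ≡ false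
    towards-nothing a = go (suc (toℕ a)) a ≤-refl
      where
      go : ∀ f a → toℕ a < f → a ≢ x → towardsFuel f a ≡ nothing → inSubtreeFuel f x a ≡ false
      go (suc f) fz a<f 0≢x eq with fz Fin.≟ x
      ... | yes 0≡x = ⊥-elim (0≢x 0≡x)
      ... | no _ = refl
      go (suc f) (fs i) a<f a≢x eq with parent i Fin.≟ x
      go (suc f) (fs i) a<f a≢x () | yes _
      ... | no p≢x with fs i Fin.≟ x
      ... | yes a≡x = ⊥-elim (a≢x a≡x)
      ... | no _ = go f (parent i) (parent-fuel i a<f) p≢x eq

    towards-walk : ∀ {P a b} → WalkIn parent P a b → (∀ {z} → P z → z ≢ x) → towards a ≡ towards b
    towards-walk (here _) avoid = refl
    towards-walk (step _ (inj₁ (i , refl , refl)) w) avoid =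
      trans (towards-step i (avoid (walk-head w))) (towards-walk w avoid)
      where
      walk-head : ∀ {P a b} → WalkIn parent P a b → P a
      walk-head (here p) = p
      walk-head (step p _ _) = p
    towards-walk (step Pa (inj₂ (i , refl , refl)) w) avoid =
      trans (sym (towards-step i (avoid Pa))) (towards-walk w avoid)

module Separator {V : Set} {E : V → V → Set} (_≟_ : DecidableEquality V) (D : TreeDecomposition E)
  {q : ℕ} (Q : Fin q → V) (q≥1 : 1 ≤ q) where

  open import Data.List.Membership.DecPropositional _≟_ using (_∈?_)
  open Rooted (parent D) (parent< D)

  home : V → Node
  home v = proj₁ (vertCover D v)

  weight : Node → ℕ
  weight y = count (λ j → inSubtree y (home (Q j)))

  Heavy : Node → Set
  Heavy y = q < 2 * weight y

  root-heavy : Heavy fz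
  root-heavy = subst (λ w → q < 2 * w) (sym (count-all _ (λ j → inSubtree-root (home (Q j)))))
    (subst (q <_) (sym (cong (q +_) (+-identityʳ q))) (m<m+n q q≥1))

  private
    deepest-heavy : ∃ λ z → Heavy z × (∀ y → toℕ z < toℕ y → ¬ Heavy y)
    deepest-heavy = maximal-satisfying (λ y → q <? 2 * weight y) root-heavy

  -- Descendants have larger indices than their ancestors, so every proper descendant of the
  -- heavy node of largest index is light.
  sep : Node
  sep = proj₁ deepest-heavy

  sep-heavy : Heavy sep
  sep-heavy = proj₁ (proj₂ deepest-heavy)

  beyond-sep-light : ∀ y → toℕ sep < toℕ y → ¬ Heavy y
  beyond-sep-light = proj₂ (proj₂ deepest-heavy)

  open Towards sep

  Outside : V → Set
  Outside v = ¬ v ∈ bag D sep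

  outside : V → Bool
  outside v = not (does (v ∈? bag D sep))

  outside-sound : ∀ v → outside v ≡ true → Outside v
  outside-sound v o with v ∈? bag D sep
  outside-sound v () | yes _
  ... | no v∉ = v∉

  outside-complete : ∀ v → Outside v → outside v ≡ true
  outside-complete v v∉ with v ∈? bag D sep
  ... | yes v∈ = ⊥-elim (v∉ v∈)
  ... | no _ = refl

  branch : V → Maybe Node
  branch v = towards (home v)

  home≢sep : ∀ v → Outside v → home v ≢ sep
  home≢sep v v∉ home≡sep = v∉ (subst (λ z → v ∈ bag D z) home≡sep (proj₂ (vertCover D v)))

  branch-bag : ∀ v z → Outside v → v ∈ bag D z → branch v ≡ towards z
  branch-bag v z v∉ v∈z = towards-walk (subtreeConn D v (home v) z (proj₂ (vertCover D v)) v∈z)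
    (λ {z′} v∈z′ z′≡sep → v∉ (subst (λ w → v ∈ bag D w) z′≡sep v∈z′))

  branch-edge : ∀ u v → E u v → Outside u → Outside v → branch u ≡ branch v
  branch-edge u v e u∉ v∉ with edgeCover D u v e
  ... | z , u∈z , v∈z = trans (branch-bag u z u∉ u∈z) (sym (branch-bag v z v∉ v∈z))

  branch-path : ∀ {u w} → PathIn E Outside u w → branch u ≡ branch w
  branch-path [ _ ] = refl
  branch-path (step u∉ e π) = trans (branch-edge _ _ e u∉ (PathIn-head π)) (branch-path π)

  _==ᴹ_ : Maybe Node → Maybe Node → Bool
  a ==ᴹ b = does (Maybe.≡-dec Fin._≟_ a b)

  ==ᴹ-sound : ∀ a b → a ==ᴹ b ≡ true → a ≡ b
  ==ᴹ-sound a b t with Maybe.≡-dec Fin._≟_ a b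
  ... | yes a≡b = a≡b

  ==ᴹ-complete : ∀ a b → a ≡ b → a ==ᴹ b ≡ true
  ==ᴹ-complete a b a≡b with Maybe.≡-dec Fin._≟_ a b
  ... | yes _ = refl
  ... | no a≢b = ⊥-elim (a≢b a≡b)

  inBranch : Maybe Node → Fin q → Bool
  inBranch β j = outside (Q j) ∧ (branch (Q j) ==ᴹ β)

  inBranch-outside : ∀ β j → inBranch β j ≡ true → Outside (Q j)
  inBranch-outside β j t with outside (Q j) in o
  ... | true = outside-sound (Q j) o

  inBranch-branch : ∀ β j → inBranch β j ≡ true → branch (Q j) ≡ β
  inBranch-branch β j t with outside (Q j)
  ... | true = ==ᴹ-sound _ β t

  branch-light : ∀ β → 2 * count (inBranch β) ≤ q
  branch-light (just c) with toℕ sep <? toℕ c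
  ... | yes sep<c = ≤-trans (*-monoʳ-≤ 2 (count-mono (inBranch (just c)) _ below-c))
                            (≮⇒≥ (beyond-sep-light c sep<c))
    where
    below-c : ∀ j → inBranch (just c) j ≡ true → inSubtree c (home (Q j)) ≡ true
    below-c j t = proj₁ (towards-just (home (Q j)) c (inBranch-branch (just c) j t))
  ... | no sep≮c = subst (λ k → 2 * k ≤ q) (sym (count-none (inBranch (just c)) empty)) z≤n
    where
    empty : ∀ j → inBranch (just c) j ≡ false
    empty j with inBranch (just c) j in t
    ... | false = refl
    ... | true = ⊥-elim (sep≮c (proj₂ (towards-just (home (Q j)) c (inBranch-branch (just c) j t))))
  branch-light nothing = ≤-trans (*-monoʳ-≤ 2 (count-mono (inBranch nothing) above above-sep)) above-light
    where
    above : Fin q → Bool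
    above j = not (inSubtree sep (home (Q j)))
    above-sep : ∀ j → inBranch nothing j ≡ true → above j ≡ true
    above-sep j t = cong not (towards-nothing (home (Q j)) (home≢sep (Q j) (inBranch-outside nothing j t))
                                              (inBranch-branch nothing j t))
    above-light : 2 * count above ≤ q
    above-light = <⇒≤ (+-cancelʳ-< q (2 * b) q (begin-strict
      2 * b + q      <⟨ +-monoʳ-< (2 * b) sep-heavy ⟩
      2 * b + 2 * a  ≡⟨ *-distribˡ-+ 2 b a ⟨
      2 * (b + a)    ≡⟨ cong (2 *_) (trans (+-comm b a) (count-+-count-not (λ j → inSubtree sep (home (Q j))))) ⟩
      2 * q          ≡⟨ cong (q +_) (+-identityʳ q) ⟩
      q + q          ∎))
      where
      open ≤-Reasoning
      a b : ℕ
      a = weight sep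
      b = count above

  module Routing {l : ℕ} (route : Fin q → Fin q → Fin l → V)
    (paths : ∀ i j → PathIn E (λ v → ∃ λ p → route i j p ≡ v) (Q i) (Q j))
    (tag : Fin q → Fin q → Fin l → Fin q)
    (decode : ∀ i j i′ j′ p → route i j p ≡ route i′ j′ p → tag i j p ≡ tag i′ j′ p → i ≡ i′ × j ≡ j′)
    where

    meets? : ∀ i j → Dec (∃ λ p → route i j p ∈ bag D sep)
    meets? i j = Fin.any? (λ p → route i j p ∈? bag D sep)

    meets : Fin q → Fin q → Bool
    meets i j = does (meets? i j)

    misses⇒same-branch : ∀ i j → not (meets i j) ≡ true → inBranch (branch (Q i)) j ≡ true
    misses⇒same-branch i j misses with meets? i j
    ... | no avoid = trans (cong (_∧ _) (outside-complete (Q j) (PathIn-last avoiding)))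
                           (==ᴹ-complete _ _ (sym (branch-path avoiding)))
      where
      avoiding : PathIn E Outside (Q i) (Q j)
      avoiding = PathIn-map (λ { (p , refl) v∈ → avoid (p , v∈) }) (paths i j)

    half-meet : ∀ i → q ≤ 2 * count (meets i)
    half-meet i = +-cancelʳ-≤ q q (2 * met) (begin
      q + q                ≡⟨ cong (q +_) (+-identityʳ q) ⟨
      2 * q                ≡⟨ cong (2 *_) (count-+-count-not (meets i)) ⟨
      2 * (met + missed)   ≡⟨ *-distribˡ-+ 2 met missed ⟩
      2 * met + 2 * missed ≤⟨ +-monoʳ-≤ (2 * met) missed-light ⟩
      2 * met + q          ∎)
      where
      open ≤-Reasoning
      met missed : ℕ
      met = count (meets i)
      missed = count (not ∘ meets i)
      missed-light : 2 * missed ≤ q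
      missed-light = ≤-trans (*-monoʳ-≤ 2 (count-mono _ _ (misses⇒same-branch i)))
                             (branch-light (branch (Q i)))

    meeting : ∀ {i j} → meets i j ≡ true → ∃ λ p → route i j p ∈ bag D sep
    meeting {i} {j} = does-true (meets? i j)

    unpair : Fin (q * q) → Fin q × Fin q
    unpair = remQuot {q} q

    meetsᵖ : Fin (q * q) → Bool
    meetsᵖ ij = meets (proj₁ (unpair ij)) (proj₂ (unpair ij))

    ∑-meets : ∑[ i < q ] count (meets i) ≡ count meetsᵖ
    ∑-meets = sym (trans (∑-combine q q (indicator ∘ meetsᵖ))
      (sum-cong-≗ (λ i → sum-cong-≗ (λ j → cong (λ ij → indicator (meets (proj₁ ij) (proj₂ ij)))
                                                  (Fin.remQuot-combine {q} {q} i j)))))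

    -- A meeting route is recorded by the bag position of its meeting vertex, that vertex's
    -- index p on the route, and tag; decode makes this record injective.
    record-meeting : ∀ ij → meetsᵖ ij ≡ true → Fin (length (bag D sep) * (l * q))
    record-meeting ij t = let (p , v∈) = meeting t in
      combine (index v∈) (combine p (tag (proj₁ (unpair ij)) (proj₂ (unpair ij)) p))

    record-determines : ∀ i j i′ j′ p p′ (v∈ : route i j p ∈ bag D sep) (v∈′ : route i′ j′ p′ ∈ bag D sep) →
      combine (index v∈) (combine p (tag i j p)) ≡ combine (index v∈′) (combine p′ (tag i′ j′ p′)) →
      i ≡ i′ × j ≡ j′
    record-determines i j i′ j′ p p′ v∈ v∈′ eq with Fin.combine-injective (index v∈) _ (index v∈′) _ eq
    ... | same-index , same-rest with Fin.combine-injective p _ p′ _ same-rest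
    ... | refl , same-tag = decode i j i′ j′ p same-vertex same-tag
      where
      same-vertex : route i j p ≡ route i′ j′ p
      same-vertex = trans (lookup-index v∈) (trans (cong (List.lookup (bag D sep)) same-index) (sym (lookup-index v∈′)))

    record-meeting-injective : ∀ ij ij′ t t′ → record-meeting ij t ≡ record-meeting ij′ t′ → ij ≡ ij′
    record-meeting-injective ij ij′ t t′ eq
      with record-determines _ _ _ _ _ _ (proj₂ (meeting t)) (proj₂ (meeting t′)) eq
    ... | i≡ , j≡ = trans (sym (Fin.combine-remQuot {q} q ij)) (trans (cong₂ combine i≡ j≡) (Fin.combine-remQuot {q} q ij′))

    large-sep-bag : q * q ≤ 2 * (length (bag D sep) * (l * q))
    large-sep-bag = begin
      q * q                          ≡⟨ ∑-const q q ⟨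
      ∑[ i < q ] q                   ≤⟨ ∑-mono-≤ half-meet ⟩
      ∑[ i < q ] (2 * count (meets i)) ≡⟨ *-distribˡ-sum 2 (λ i → count (meets i)) ⟨
      2 * ∑[ i < q ] count (meets i) ≡⟨ cong (2 *_) ∑-meets ⟩
      2 * count meetsᵖ               ≤⟨ *-monoʳ-≤ 2 (count-≤-injective meetsᵖ record-meeting record-meeting-injective) ⟩
      2 * (length (bag D sep) * (l * q)) ∎
      where open ≤-Reasoning

large-bag-from-routing : ∀ {V : Set} {E : V → V → Set} → DecidableEquality V → (D : TreeDecomposition E) →
  ∀ {q l} (Q : Fin q → V) → 1 ≤ q →
  (route : Fin q → Fin q → Fin l → V) →
  (∀ i j → PathIn E (λ v → ∃ λ p → route i j p ≡ v) (Q i) (Q j)) →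
  (tag : Fin q → Fin q → Fin l → Fin q) →
  (∀ i j i′ j′ p → route i j p ≡ route i′ j′ p → tag i j p ≡ tag i′ j′ p → i ≡ i′ × j ≡ j′) →
  ∃ λ x → q * q ≤ 2 * (length (bag D x) * (l * q))
large-bag-from-routing _≟_ D Q q≥1 route paths tag decode =
  _ , Separator.Routing.large-sep-bag _≟_ D Q q≥1 route paths tag decode

-- The upper bound

SizedSubset : ℕ → ℕ → Set
SizedSubset n k = Σ (Subset n) (λ A → ∣ A ∣ ≡ k)

SizedSubset-≡ : ∀ {n k} {A B : Subset n} {p : ∣ A ∣ ≡ k} {q : ∣ B ∣ ≡ k} → A ≡ B → (A , p) ≡ (B , q)
SizedSubset-≡ {p = p} {q} refl = cong (_ ,_) (≡-irrelevant p q)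

_≟-SizedSubset_ : ∀ {n k} → DecidableEquality (SizedSubset n k)
(A , _) ≟-SizedSubset (B , _) with Vec.≡-dec Data.Bool._≟_ A B
... | yes A≡B = yes (SizedSubset-≡ A≡B)
... | no A≢B = no (A≢B ∘ cong proj₁)

without₀ : ∀ {n k} → SizedSubset n k → SizedSubset (suc n) k
without₀ (A , p) = (false ∷ A , p)

with₀ : ∀ {n k} → SizedSubset n k → SizedSubset (suc n) (suc k)
with₀ (A , p) = (true ∷ A , cong suc p)

without₀-injective : ∀ {n k} {A B : SizedSubset n k} → without₀ A ≡ without₀ B → A ≡ B
without₀-injective e = SizedSubset-≡ (Vec.∷-injectiveʳ (cong proj₁ e))

with₀-injective : ∀ {n k} {A B : SizedSubset n k} → with₀ A ≡ with₀ B → A ≡ B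
with₀-injective e = SizedSubset-≡ (Vec.∷-injectiveʳ (cong proj₁ e))

∈-map-with₀ : ∀ {n k} {A : SizedSubset (suc n) (suc k)} xs → A ∈ map with₀ xs → head (proj₁ A) ≡ true
∈-map-with₀ xs A∈ with ∈-map⁻ with₀ A∈
... | _ , _ , refl = refl

∈-map-without₀ : ∀ {n k} {A : SizedSubset (suc n) k} xs → A ∈ map without₀ xs → head (proj₁ A) ≡ false
∈-map-without₀ xs A∈ with ∈-map⁻ without₀ A∈
... | _ , _ , refl = refl

subsetsOfSize : (n k : ℕ) → List (SizedSubset n k)
subsetsOfSize zero zero = ([] , refl) ∷ []
subsetsOfSize zero (suc k) = []
subsetsOfSize (suc n) zero = map without₀ (subsetsOfSize n zero)
subsetsOfSize (suc n) (suc k) = map with₀ (subsetsOfSize n k) ++ map without₀ (subsetsOfSize n (suc k))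

true≢false : true ≢ false
true≢false ()

disjoint-with₀-without₀ : ∀ {n k} {A : SizedSubset (suc n) (suc k)} xs ys →
  A ∈ map with₀ xs → ¬ A ∈ map without₀ ys
disjoint-with₀-without₀ xs ys A∈xs A∈ys = true≢false (trans (sym (∈-map-with₀ xs A∈xs)) (∈-map-without₀ ys A∈ys))

subsetsOfSize-unique : ∀ n k → Unique (subsetsOfSize n k)
subsetsOfSize-unique zero zero = [] ∷ []
subsetsOfSize-unique zero (suc k) = []
subsetsOfSize-unique (suc n) zero = Unique.map⁺ without₀-injective (subsetsOfSize-unique n zero)
subsetsOfSize-unique (suc n) (suc k) =
  Unique.++⁺ (Unique.map⁺ with₀-injective (subsetsOfSize-unique n k))
             (Unique.map⁺ without₀-injective (subsetsOfSize-unique n (suc k)))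
             (λ (A∈xs , A∈ys) → disjoint-with₀-without₀ (subsetsOfSize n k) _ A∈xs A∈ys)

subsetsOfSize-complete : ∀ n k (A : SizedSubset n k) → A ∈ subsetsOfSize n k
subsetsOfSize-complete zero zero ([] , p) = here (SizedSubset-≡ refl)
subsetsOfSize-complete zero (suc k) ([] , ())
subsetsOfSize-complete (suc n) zero (false ∷ A , p) = ∈-map⁺ without₀ (subsetsOfSize-complete n zero (A , p))
subsetsOfSize-complete (suc n) zero (true ∷ A , ())
subsetsOfSize-complete (suc n) (suc k) (false ∷ A , p) =
  ∈-++⁺ʳ (map with₀ (subsetsOfSize n k)) (∈-map⁺ without₀ (subsetsOfSize-complete n (suc k) (A , p)))
subsetsOfSize-complete (suc n) (suc k) (true ∷ A , p) =
  ∈-++⁺ˡ (subst (_∈ map with₀ (subsetsOfSize n k)) (SizedSubset-≡ refl)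
                (∈-map⁺ with₀ (subsetsOfSize-complete n k (A , suc-injective p))))

length-subsetsOfSize : ∀ n k → length (subsetsOfSize n k) ≤ n ^ k
length-subsetsOfSize zero zero = ≤-refl
length-subsetsOfSize zero (suc k) = z≤n
length-subsetsOfSize (suc n) zero = ≤-trans (≤-reflexive (length-map without₀ (subsetsOfSize n zero))) (length-subsetsOfSize n zero)
length-subsetsOfSize (suc n) (suc k) = begin
  length (map with₀ (subsetsOfSize n k) ++ map without₀ (subsetsOfSize n (suc k)))
    ≡⟨ length-++ (map with₀ (subsetsOfSize n k)) ⟩
  length (map with₀ (subsetsOfSize n k)) + length (map without₀ (subsetsOfSize n (suc k)))
    ≡⟨ cong₂ _+_ (length-map with₀ (subsetsOfSize n k)) (length-map without₀ (subsetsOfSize n (suc k))) ⟩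
  length (subsetsOfSize n k) + length (subsetsOfSize n (suc k))
    ≤⟨ +-mono-≤ (length-subsetsOfSize n k) (length-subsetsOfSize n (suc k)) ⟩
  n ^ k + n * n ^ k
    ≤⟨ +-mono-≤ (^-monoˡ-≤ k (n≤1+n n)) (*-monoʳ-≤ n (^-monoˡ-≤ k (n≤1+n n))) ⟩
  suc n ^ k + n * suc n ^ k ∎
  where open ≤-Reasoning

lookup-injective : ∀ {A : Set} {xs : List A} → Unique xs → ∀ i j → List.lookup xs i ≡ List.lookup xs j → i ≡ j
lookup-injective {xs = x ∷ xs} u fz fz e = refl
lookup-injective {xs = x ∷ xs} (x∉ ∷ u) fz (fs j) e = ⊥-elim (All.lookup x∉ (∈-lookup j) e)
lookup-injective {xs = x ∷ xs} (x∉ ∷ u) (fs i) fz e = ⊥-elim (All.lookup x∉ (∈-lookup i) (sym e))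
lookup-injective {xs = x ∷ xs} (_ ∷ u) (fs i) (fs j) e = cong fs (lookup-injective u i j e)

module StarDecomposition (n k : ℕ) where

  Token : Set
  Token = TokenV n (suc k)

  centred uncentred : List Token
  centred = map with₀ (subsetsOfSize n k)
  uncentred = map without₀ (subsetsOfSize n (suc k))

  leaves : ℕ
  leaves = length uncentred

  starBag : Fin (suc leaves) → List Token
  starBag fz = centred
  starBag (fs i) = centred ++ List.lookup uncentred i ∷ []

  ∈-centred : ∀ A → head (proj₁ A) ≡ true → A ∈ centred
  ∈-centred (true ∷ A , p) _ = subst (_∈ centred) (SizedSubset-≡ refl)
                                      (∈-map⁺ with₀ (subsetsOfSize-complete n k (A , suc-injective p)))

  ∈-uncentred : ∀ A → head (proj₁ A) ≡ false → A ∈ uncentred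
  ∈-uncentred (false ∷ A , p) _ = ∈-map⁺ without₀ (subsetsOfSize-complete n (suc k) (A , p))

  centred-everywhere : ∀ {A} → A ∈ centred → ∀ x → A ∈ starBag x
  centred-everywhere A∈ fz = A∈
  centred-everywhere A∈ (fs i) = ∈-++⁺ˡ A∈

  starBag-leaf : ∀ {A} (A∈ : A ∈ uncentred) → A ∈ starBag (fs (index A∈))
  starBag-leaf A∈ = ∈-++⁺ʳ centred (here (lookup-index A∈))

  uncentred∉centred : ∀ {A} → head (proj₁ A) ≡ false → ¬ A ∈ centred
  uncentred∉centred h A∈ = true≢false (trans (sym (∈-map-with₀ (subsetsOfSize n k) A∈)) h)

  uncentred-in-leaf : ∀ {A} i → head (proj₁ A) ≡ false → A ∈ starBag (fs i) → A ≡ List.lookup uncentred i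
  uncentred-in-leaf i h A∈ with ∈-++⁻ centred A∈
  ... | inj₁ A∈centred = ⊥-elim (uncentred∉centred h A∈centred)
  ... | inj₂ (here A≡) = A≡

  starBag-unique : ∀ x → Unique (starBag x)
  starBag-unique fz = Unique.map⁺ with₀-injective (subsetsOfSize-unique n k)
  starBag-unique (fs i) = Unique.++⁺ (starBag-unique fz) ([] ∷ [])
    (λ { (A∈ , here refl) → disjoint-with₀-without₀ (subsetsOfSize n k) (subsetsOfSize n (suc k)) A∈ (∈-lookup i) })

  starBag-cover : ∀ A → ∃ λ x → A ∈ starBag x
  starBag-cover A with head (proj₁ A) in h
  ... | true = fz , ∈-centred A h
  ... | false = let A∈ = ∈-uncentred A h in fs (index A∈) , starBag-leaf A∈

  centre-∈⇒head : ∀ {A : Subset (suc n)} → fz S.∈ A → head A ≡ true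
  centre-∈⇒head here = refl

  edge-touches-centre : ∀ A B → TokenAdj n (suc k) A B → head (proj₁ A) ≡ true ⊎ head (proj₁ B) ≡ true
  edge-touches-centre A B (u , v , inj₁ (refl , _) , u∈A , _) = inj₁ (centre-∈⇒head u∈A)
  edge-touches-centre A B (u , v , inj₂ (refl , _) , _ , _ , v∈B , _) = inj₂ (centre-∈⇒head v∈B)

  starBag-edge : ∀ A B → TokenAdj n (suc k) A B → ∃ λ x → A ∈ starBag x × B ∈ starBag x
  starBag-edge A B adj with edge-touches-centre A B adj
  ... | inj₁ hA = let (x , B∈) = starBag-cover B in x , centred-everywhere (∈-centred A hA) x , B∈
  ... | inj₂ hB = let (x , A∈) = starBag-cover A in x , A∈ , centred-everywhere (∈-centred B hB) x

  from-hub : ∀ {P : Fin (suc leaves) → Set} → (∀ z → P z) → ∀ y → WalkIn (λ _ → fz) P fz y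
  from-hub all fz = here (all fz)
  from-hub all (fs j) = step (all fz) (inj₂ (j , refl , refl)) (here (all (fs j)))

  star-walk : ∀ {P : Fin (suc leaves) → Set} → (∀ z → P z) → ∀ x y → WalkIn (λ _ → fz) P x y
  star-walk all fz y = from-hub all y
  star-walk all (fs i) y = step (all (fs i)) (inj₁ (i , refl , refl)) (from-hub all y)

  starBag-connected : ∀ A x y → A ∈ starBag x → A ∈ starBag y → WalkIn (λ _ → fz) (λ z → A ∈ starBag z) x y
  starBag-connected A x y A∈x A∈y with head (proj₁ A) in h
  ... | true = star-walk (centred-everywhere (∈-centred A h)) x y
  starBag-connected A fz y A∈x A∈y | false = ⊥-elim (uncentred∉centred h A∈x)
  starBag-connected A (fs i) fz A∈x A∈y | false = ⊥-elim (uncentred∉centred h A∈y)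
  starBag-connected A (fs i) (fs j) A∈x A∈y | false
    with lookup-injective (Unique.map⁺ without₀-injective (subsetsOfSize-unique n (suc k))) i j
           (trans (sym (uncentred-in-leaf i h A∈x)) (uncentred-in-leaf j h A∈y))
  ... | refl = here A∈x

  starDecomposition : TreeDecomposition (TokenAdj n (suc k))
  starDecomposition = record
    { t = leaves ; parent = λ _ → fz ; parent< = λ _ → z≤n
    ; bag = starBag ; bagUnique = starBag-unique ; vertCover = starBag-cover
    ; edgeCover = starBag-edge ; subtreeConn = starBag-connected }

  length-centred : length centred ≤ n ^ k
  length-centred = ≤-trans (≤-reflexive (length-map with₀ (subsetsOfSize n k))) (length-subsetsOfSize n k)

  starDecomposition-width : WidthAtMost starDecomposition (n ^ k)
  starDecomposition-width fz = ≤-trans length-centred (n≤1+n _)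
  starDecomposition-width (fs i) = ≤-trans (≤-reflexive (trans (length-++ centred) (+-comm _ 1))) (s≤s length-centred)

tw-token-star-≤ : ∀ n k → TwAtMost (TokenAdj n (suc k)) (1 * n ^ k)
tw-token-star-≤ n k = starDecomposition , subst (WidthAtMost starDecomposition) (sym (*-identityˡ _)) starDecomposition-width
  where open StarDecomposition n k

-- A grid of k-sets in the token graph

TokenAdj-intro : ∀ {n k} (A B : TokenV n k) u v → StarEdge n u v →
  lookup (proj₁ A) u ≡ true → lookup (proj₁ B) u ≡ false →
  lookup (proj₁ B) v ≡ true → lookup (proj₁ A) v ≡ false →
  (∀ w → w ≢ u → w ≢ v → lookup (proj₁ A) w ≡ lookup (proj₁ B) w) → TokenAdj n k A B
TokenAdj-intro (A , _) (B , _) u v uv u∈A u∉B v∈B v∉A same =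
  u , v , uv , Vec.lookup⇒[]= u A u∈A , ∉ B u u∉B , Vec.lookup⇒[]= v B v∈B , ∉ A v v∉A ,
  λ w w≢u w≢v → mk⇔ (λ w∈A → Vec.lookup⇒[]= w B (trans (sym (same w w≢u w≢v)) (Vec.[]=⇒lookup w∈A)))
                    (λ w∈B → Vec.lookup⇒[]= w A (trans (same w w≢u w≢v) (Vec.[]=⇒lookup w∈B)))
  where
  ∉ : ∀ {n} (A : Subset n) w → lookup A w ≡ false → ¬ w S.∈ A
  ∉ A w w∉ w∈ with trans (sym w∉) (Vec.[]=⇒lookup w∈)
  ... | ()

fs≢fz : ∀ {n} {x : Fin n} → fs x ≢ fz
fs≢fz ()

-- The leaves of S_N, N = d m + r, are split into d blocks of m leaves plus r spare leaves.
-- A grid point g : Fin d → Fin m is the (d+1)-set X g holding the centre and leaf g j of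
-- every block j; Y g i b is X g with the centre token moved to leaf b of block i.
module TokenGrid (d m r : ℕ) where

  N : ℕ
  N = d * m + r

  Grid : Set
  Grid = Fin d → Fin m

  Token : Set
  Token = TokenV N (suc d)

  leafAt : Fin d → Fin m → Fin (suc N)
  leafAt j u = fs (combine j u ↑ˡ r)

  spareAt : Fin r → Fin (suc N)
  spareAt z = fs ((d * m) ↑ʳ z)

  data Position : Fin (suc N) → Set where
    centre : Position fz
    leaf : ∀ j u → Position (leafAt j u)
    spare : ∀ z → Position (spareAt z)

  position : ∀ w → Position w
  position fz = centre
  position (fs p) with splitAt (d * m) p in eq
  ... | inj₂ z = subst (Position ∘ fs) (Fin.splitAt⁻¹-↑ʳ eq) (spare z)
  ... | inj₁ c with Fin.combine-surjective {d} {m} c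
  ...   | j , u , refl = subst (Position ∘ fs) (Fin.splitAt⁻¹-↑ˡ eq) (leaf j u)

  tokens : Bool → (Fin d → Fin m → Bool) → Subset (suc N)
  tokens c f = c ∷ (concat (tabulate (λ j → tabulate (f j))) ++ᵛ replicate r false)

  tokens-leaf : ∀ c f j u → lookup (tokens c f) (leafAt j u) ≡ f j u
  tokens-leaf c f j u = begin
    lookup (concat (tabulate (λ j → tabulate (f j))) ++ᵛ replicate r false) (combine j u ↑ˡ r)
      ≡⟨ Vec.lookup-++ˡ (concat (tabulate (λ j → tabulate (f j)))) _ (combine j u) ⟩
    lookup (concat (tabulate (λ j → tabulate (f j)))) (combine j u)
      ≡⟨ Vec.lookup-concat (tabulate (λ j → tabulate (f j))) j u ⟩
    lookup (lookup (tabulate (λ j → tabulate (f j))) j) u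
      ≡⟨ cong (λ v → lookup v u) (Vec.lookup∘tabulate (λ j → tabulate (f j)) j) ⟩
    lookup (tabulate (f j)) u
      ≡⟨ Vec.lookup∘tabulate (f j) u ⟩
    f j u ∎
    where open ≡-Reasoning

  tokens-spare : ∀ c f z → lookup (tokens c f) (spareAt z) ≡ false
  tokens-spare c f z = trans (Vec.lookup-++ʳ (concat (tabulate (λ j → tabulate (f j)))) _ z)
                             (Vec.lookup-replicate z false)

  ∣tokens∣ : ∀ c f → ∣ tokens c f ∣ ≡ indicator c + ∑[ j < d ] count (f j)
  ∣tokens∣ c f = trans (∣∷∣ c (concat (tabulate (λ j → tabulate (f j))) ++ᵛ replicate r false)) (cong (indicator c +_) (begin
    ∣ concat (tabulate (λ j → tabulate (f j))) ++ᵛ replicate r false ∣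
      ≡⟨ ∣++∣ (concat (tabulate (λ j → tabulate (f j)))) _ ⟩
    ∣ concat (tabulate (λ j → tabulate (f j))) ∣ + ∣ replicate r false ∣
      ≡⟨ cong₂ _+_ (∣concat∣ (λ j → tabulate (f j))) (∣⊥∣≡0 r) ⟩
    ∑[ j < d ] ∣ tabulate (f j) ∣ + 0
      ≡⟨ +-identityʳ _ ⟩
    ∑[ j < d ] ∣ tabulate (f j) ∣
      ≡⟨ sum-cong-≗ (λ j → ∣tabulate∣ (f j)) ⟩
    ∑[ j < d ] count (f j) ∎))
    where
    open ≡-Reasoning
    ∣∷∣ : ∀ {n} c (A : Subset n) → ∣ c ∷ A ∣ ≡ indicator c + ∣ A ∣
    ∣∷∣ true A = refl
    ∣∷∣ false A = refl

  occupied : Grid → Fin d → Fin m → Bool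
  occupied g j u = g j == u

  moved : Grid → Fin d → Fin m → Fin d → Fin m → Bool
  moved g i b j u = (g j == u) ∨ ((i == j) ∧ (b == u))

  ∣occupied∣ : ∀ g → ∑[ j < d ] count (occupied g j) ≡ d
  ∣occupied∣ g = trans (sum-cong-≗ (λ j → count-== (g j))) (trans (∑-const d 1) (*-identityʳ d))

  count-moved : ∀ g i b → g i ≢ b → ∀ j → count (moved g i b j) ≡ 1 + indicator (i == j)
  count-moved g i b gi≢b j with i Fin.≟ j
  ... | no _ = trans (sum-cong-≗ (λ u → cong indicator (∨-false (g j == u)))) (count-== (g j))
    where
    ∨-false : ∀ a → (a ∨ false) ≡ a
    ∨-false true = refl
    ∨-false false = refl
  ... | yes refl = begin
    ∑[ u < m ] indicator ((g i == u) ∨ (b == u))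
      ≡⟨ sum-cong-≗ (λ u → indicator-∨ (g i == u) (b == u) (disjoint u)) ⟩
    ∑[ u < m ] (indicator (g i == u) + indicator (b == u))
      ≡⟨ ∑-distrib-+ (λ u → indicator (g i == u)) (λ u → indicator (b == u)) ⟩
    count (g i ==_) + count (b ==_)
      ≡⟨ cong₂ _+_ (count-== (g i)) (count-== b) ⟩
    2 ∎
    where
    open ≡-Reasoning
    indicator-∨ : ∀ a b → (a ∧ b) ≡ false → indicator (a ∨ b) ≡ indicator a + indicator b
    indicator-∨ true true ()
    indicator-∨ true false _ = refl
    indicator-∨ false b _ = refl
    disjoint : ∀ u → ((g i == u) ∧ (b == u)) ≡ false
    disjoint u with g i Fin.≟ u | b Fin.≟ u
    ... | yes refl | yes refl = ⊥-elim (gi≢b refl)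
    ... | yes _ | no _ = refl
    ... | no _ | _ = refl

  ∣moved∣ : ∀ g i b → g i ≢ b → ∑[ j < d ] count (moved g i b j) ≡ suc d
  ∣moved∣ g i b gi≢b = begin
    ∑[ j < d ] count (moved g i b j)       ≡⟨ sum-cong-≗ (count-moved g i b gi≢b) ⟩
    ∑[ j < d ] (1 + indicator (i == j))    ≡⟨ ∑-distrib-+ (λ _ → 1) (λ j → indicator (i == j)) ⟩
    ∑[ j < d ] 1 + count (i ==_)           ≡⟨ cong₂ _+_ (trans (∑-const d 1) (*-identityʳ d)) (count-== i) ⟩
    d + 1                                  ≡⟨ +-comm d 1 ⟩
    suc d                                  ∎
    where open ≡-Reasoning

  X : Grid → Token
  X g = tokens true (occupied g) , trans (∣tokens∣ true (occupied g)) (cong suc (∣occupied∣ g))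

  Y : ∀ g i b → g i ≢ b → Token
  Y g i b gi≢b = tokens false (moved g i b) , trans (∣tokens∣ false (moved g i b)) (∣moved∣ g i b gi≢b)

  X-cong : ∀ {g g′} → (∀ j → g j ≡ g′ j) → X g ≡ X g′
  X-cong g≗g′ = SizedSubset-≡ (cong (λ v → true ∷ (concat v ++ᵛ replicate r false))
    (Vec.tabulate-cong (λ j → Vec.tabulate-cong (λ u → cong (_== u) (g≗g′ j)))))

  X-injective : ∀ g g′ → X g ≡ X g′ → ∀ j → g j ≡ g′ j
  X-injective g g′ e j = sym (==-sound (begin
    g′ j == g j                            ≡⟨ tokens-leaf true (occupied g′) j (g j) ⟨
    lookup (tokens true (occupied g′)) (leafAt j (g j)) ≡⟨ cong (λ A → lookup (proj₁ A) (leafAt j (g j))) e ⟨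
    lookup (tokens true (occupied g)) (leafAt j (g j))  ≡⟨ tokens-leaf true (occupied g) j (g j) ⟩
    g j == g j                             ≡⟨ ==-refl (g j) ⟩
    true                                   ∎))
    where open ≡-Reasoning

  Y-injective : ∀ g g′ i {b b′} gi≢b g′i≢b′ → b ≡ b′ → Y g i b gi≢b ≡ Y g′ i b′ g′i≢b′ → ∀ j → g j ≡ g′ j
  Y-injective g g′ i {b} gi≢b g′i≢b refl e j = sym (recover (i Fin.≟ j) g′-has-gj)
    where
    g′-has-gj : moved g′ i b j (g j) ≡ true
    g′-has-gj = begin
      moved g′ i b j (g j)                             ≡⟨ tokens-leaf false (moved g′ i b) j (g j) ⟨
      lookup (tokens false (moved g′ i b)) (leafAt j (g j)) ≡⟨ cong (λ A → lookup (proj₁ A) (leafAt j (g j))) e ⟨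
      lookup (tokens false (moved g i b)) (leafAt j (g j))  ≡⟨ tokens-leaf false (moved g i b) j (g j) ⟩
      (g j == g j) ∨ ((i == j) ∧ (b == g j))            ≡⟨ cong (_∨ ((i == j) ∧ (b == g j))) (==-refl (g j)) ⟩
      true                                             ∎
      where open ≡-Reasoning
    -- b ≠ g i rules out the moved token, so the token in block j sits at g′ j
    recover : Dec (i ≡ j) → moved g′ i b j (g j) ≡ true → g′ j ≡ g j
    recover (yes refl) t with g′ i == g i in e′
    ... | true = ==-sound e′
    ... | false rewrite ==-refl i = ⊥-elim (gi≢b (sym (==-sound t)))
    recover (no i≢j) t with g′ j == g j in e′
    ... | true = ==-sound e′
    ... | false rewrite ==-false i≢j with t
    ...   | ()

  X≢Y : ∀ g g′ i b g′i≢b → X g ≢ Y g′ i b g′i≢b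
  X≢Y g g′ i b g′i≢b e with cong (λ A → lookup (proj₁ A) fz) e
  ... | ()

  X-adj-Y : ∀ g i b (gi≢b : g i ≢ b) → TokenAdj N (suc d) (X g) (Y g i b gi≢b)
  X-adj-Y g i b gi≢b = TokenAdj-intro (X g) (Y g i b gi≢b) fz (leafAt i b) (inj₁ (refl , fs≢fz))
    refl refl
    (trans (tokens-leaf false (moved g i b) i b) (new-token (g i == b)))
    (trans (tokens-leaf true (occupied g) i b) (==-false gi≢b))
    elsewhere
    where
    new-token : ∀ a → (a ∨ ((i == i) ∧ (b == b))) ≡ true
    new-token true = refl
    new-token false rewrite ==-refl i | ==-refl b = refl
    elsewhere : ∀ w → w ≢ fz → w ≢ leafAt i b →
      lookup (tokens true (occupied g)) w ≡ lookup (tokens false (moved g i b)) w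
    elsewhere w w≢0 w≢ib with position w
    ... | centre = ⊥-elim (w≢0 refl)
    ... | spare z = trans (tokens-spare true _ z) (sym (tokens-spare false _ z))
    ... | leaf j u = trans (tokens-leaf true _ j u) (trans (∨-absorb (g j == u)) (sym (tokens-leaf false _ j u)))
      where
      not-new : ((i == j) ∧ (b == u)) ≡ false
      not-new with i Fin.≟ j | b Fin.≟ u
      ... | yes refl | yes refl = ⊥-elim (w≢ib refl)
      ... | yes _ | no _ = refl
      ... | no _ | _ = refl
      ∨-absorb : ∀ a → a ≡ (a ∨ ((i == j) ∧ (b == u)))
      ∨-absorb true = refl
      ∨-absorb false = sym not-new

  update : Grid → Fin d → Fin m → Grid
  update g i b j = if i == j then b else g j

  Y-adj-X : ∀ g i b (gi≢b : g i ≢ b) → TokenAdj N (suc d) (Y g i b gi≢b) (X (update g i b))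
  Y-adj-X g i b gi≢b = TokenAdj-intro (Y g i b gi≢b) (X (update g i b)) (leafAt i (g i)) fz (inj₂ (refl , fs≢fz))
    (trans (tokens-leaf false _ i (g i)) (cong (_∨ ((i == i) ∧ (b == g i))) (==-refl (g i))))
    (trans (tokens-leaf true _ i (g i))
           (trans (cong (λ a → (if a then b else g i) == g i) (==-refl i)) (==-false (gi≢b ∘ sym))))
    refl refl
    elsewhere
    where
    elsewhere : ∀ w → w ≢ leafAt i (g i) → w ≢ fz →
      lookup (tokens false (moved g i b)) w ≡ lookup (tokens true (occupied (update g i b))) w
    elsewhere w w≢igi w≢0 with position w
    ... | centre = ⊥-elim (w≢0 refl)
    ... | spare z = trans (tokens-spare false _ z) (sym (tokens-spare true _ z))
    ... | leaf j u = trans (tokens-leaf false _ j u) (trans moved≡ (sym (tokens-leaf true _ j u)))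
      where
      moved≡ : ((g j == u) ∨ ((i == j) ∧ (b == u))) ≡ (update g i b j == u)
      moved≡ with i Fin.≟ j
      ... | no _ with g j == u
      ...   | true = refl
      ...   | false = refl
      moved≡ | yes refl with g i Fin.≟ u
      ... | yes refl = ⊥-elim (w≢igi refl)
      ... | no _ = refl

  mix : ℕ → Grid → Grid → Grid
  mix i g h j with toℕ j <? i
  ... | yes _ = h j
  ... | no _ = g j

  mix-zero : ∀ g h j → mix 0 g h j ≡ g j
  mix-zero g h j with toℕ j <? 0
  ... | no _ = refl

  mix-full : ∀ g h j → mix d g h j ≡ h j
  mix-full g h j with toℕ j <? d
  ... | yes _ = refl
  ... | no j≮d = ⊥-elim (j≮d (Fin.toℕ<n j))

  mix-at : ∀ g h j → mix (toℕ j) g h j ≡ g j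
  mix-at g h j with toℕ j <? toℕ j
  ... | yes j<j = ⊥-elim (<-irrefl refl j<j)
  ... | no _ = refl

  mix-at-≢ : ∀ {g h j} → g j ≢ h j → mix (toℕ j) g h j ≢ h j
  mix-at-≢ {g} {h} {j} gj≢hj e = gj≢hj (trans (sym (mix-at g h j)) e)

  mix-suc-at : ∀ g h j → mix (suc (toℕ j)) g h j ≡ h j
  mix-suc-at g h j with toℕ j <? suc (toℕ j)
  ... | yes _ = refl
  ... | no j≮1+j = ⊥-elim (j≮1+j ≤-refl)

  mix-suc-other : ∀ g h {j j′} → j ≢ j′ → mix (toℕ j) g h j′ ≡ mix (suc (toℕ j)) g h j′
  mix-suc-other g h {j} {j′} j≢j′ with toℕ j′ <? toℕ j | toℕ j′ <? suc (toℕ j)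
  ... | yes _ | yes _ = refl
  ... | no _ | no _ = refl
  ... | yes j′<j | no j′≮1+j = ⊥-elim (j′≮1+j (m<n⇒m<1+n j′<j))
  ... | no j′≮j | yes j′<1+j = ⊥-elim (j≢j′ (Fin.toℕ-injective (sym (≤∧≮⇒≡ (s≤s⁻¹ j′<1+j) j′≮j))))
    where open import Data.Nat using (s≤s⁻¹)

  mix-suc-agree : ∀ g h j → g j ≡ h j → ∀ j′ → mix (toℕ j) g h j′ ≡ mix (suc (toℕ j)) g h j′
  mix-suc-agree g h j gj≡hj j′ with j Fin.≟ j′
  ... | yes refl = trans (mix-at g h j) (trans gj≡hj (sym (mix-suc-at g h j)))
  ... | no j≢j′ = mix-suc-other g h j≢j′

  mix-suc-update : ∀ g h j j′ → update (mix (toℕ j) g h) j (h j) j′ ≡ mix (suc (toℕ j)) g h j′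
  mix-suc-update g h j j′ with j Fin.≟ j′
  ... | yes refl = sym (mix-suc-at g h j)
  ... | no j≢j′ = mix-suc-other g h j≢j′

  mix-determines : ∀ i {g h g′ h′} → (∀ j → mix i g h j ≡ mix i g′ h′ j) → (∀ j → mix i h g j ≡ mix i h′ g′ j) →
    (∀ j → g j ≡ g′ j) × (∀ j → h j ≡ h′ j)
  mix-determines i {g} {h} {g′} {h′} e e′ = recover-g , recover-h
    where
    recover-g : ∀ j → g j ≡ g′ j
    recover-g j with toℕ j <? i | e j | e′ j
    ... | yes _ | _ | gj≡ = gj≡
    ... | no _ | gj≡ | _ = gj≡
    recover-h : ∀ j → h j ≡ h′ j
    recover-h j with toℕ j <? i | e j | e′ j
    ... | yes _ | hj≡ | _ = hj≡
    ... | no _ | _ | hj≡ = hj≡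

  Stop : Set
  Stop = Fin (suc d) ⊎ Fin d

  waypoint : ∀ g h j → Dec (g j ≡ h j) → Token
  waypoint g h j (yes _) = X (mix (toℕ j) g h)
  waypoint g h j (no gj≢hj) = Y (mix (toℕ j) g h) j (h j) (mix-at-≢ {g} {h} {j} gj≢hj)

  -- The route from X g to X h visits X (mix i g h) for i = 0 … d, passing through the
  -- waypoint Y (mix j g h) j (h j) whenever coordinate j changes.
  stop : Grid → Grid → Stop → Token
  stop g h (inj₁ i) = X (mix (toℕ i) g h)
  stop g h (inj₂ j) = waypoint g h j (g j Fin.≟ h j)

  stopTag : Grid → Grid → Stop → Grid
  stopTag g h (inj₁ i) = mix (toℕ i) h g
  stopTag g h (inj₂ j) = mix (toℕ j) h g

  stop-decode : ∀ g h g′ h′ s → stop g h s ≡ stop g′ h′ s → (∀ j → stopTag g h s j ≡ stopTag g′ h′ s j) →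
    (∀ j → g j ≡ g′ j) × (∀ j → h j ≡ h′ j)
  stop-decode g h g′ h′ (inj₁ i) e t = mix-determines (toℕ i) (X-injective _ _ e) t
  stop-decode g h g′ h′ (inj₂ j) e t with g j Fin.≟ h j | g′ j Fin.≟ h′ j
  ... | yes _ | yes _ = mix-determines (toℕ j) (X-injective _ _ e) t
  ... | yes _ | no _ = ⊥-elim (X≢Y _ _ _ _ _ e)
  ... | no _ | yes _ = ⊥-elim (X≢Y _ _ _ _ _ (sym e))
  ... | no _ | no _ = mix-determines (toℕ j) (Y-injective _ _ j _ _ hj≡h′j e) t
    where hj≡h′j = trans (sym (mix-at h g j)) (trans (t j) (mix-at h′ g′ j))

  module Route (g h : Grid) where

    OnRoute : Token → Set
    OnRoute v = ∃ λ s → stop g h s ≡ v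

    Walk : Token → Token → Set
    Walk = PathIn (TokenAdj N (suc d)) OnRoute

    X-on-route : ∀ i → i < suc d → OnRoute (X (mix i g h))
    X-on-route i i≤d = inj₁ (fromℕ< i≤d) , cong (λ k → X (mix k g h)) (Fin.toℕ-fromℕ< i≤d)

    waypoint-on-route : ∀ j → OnRoute (waypoint g h j (g j Fin.≟ h j))
    waypoint-on-route j = inj₂ j , refl

    segment : ∀ j → Walk (X (mix (toℕ j) g h)) (X (mix (suc (toℕ j)) g h))
    segment j with g j Fin.≟ h j | waypoint-on-route j
    ... | yes gj≡hj | _ = subst (Walk (X (mix (toℕ j) g h))) (X-cong (mix-suc-agree g h j gj≡hj))
                                [ X-on-route (toℕ j) j≤d ]
      where
      j≤d : toℕ j < suc d
      j≤d = m<n⇒m<1+n (Fin.toℕ<n j)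
    ... | no gj≢hj | Y-on = subst (Walk (X (mix (toℕ j) g h))) (X-cong (mix-suc-update g h j))
      (step (X-on-route (toℕ j) (m<n⇒m<1+n (Fin.toℕ<n j))) (X-adj-Y (mix (toℕ j) g h) j (h j) (mix-at-≢ {g} {h} {j} gj≢hj))
      (step Y-on (Y-adj-X (mix (toℕ j) g h) j (h j) (mix-at-≢ {g} {h} {j} gj≢hj))
      [ subst OnRoute (sym (X-cong (mix-suc-update g h j))) (X-on-route (suc (toℕ j)) (s≤s (Fin.toℕ<n j))) ]))

    prefix : ∀ i → i ≤ d → Walk (X (mix 0 g h)) (X (mix i g h))
    prefix zero _ = [ X-on-route 0 (s≤s z≤n) ]
    prefix (suc i) i<d = prefix i (<⇒≤ i<d) ++ᵖ
      subst (λ k → Walk (X (mix k g h)) (X (mix (suc k) g h))) (Fin.toℕ-fromℕ< i<d) (segment (fromℕ< i<d))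

    route : Walk (X g) (X h)
    route = subst₂ Walk (X-cong (mix-zero g h)) (X-cong (mix-full g h)) (prefix d ≤-refl)

funToFin-cong : ∀ {d m} {f f′ : Fin d → Fin m} → (∀ j → f j ≡ f′ j) → funToFin f ≡ funToFin f′
funToFin-cong {zero} e = refl
funToFin-cong {suc d} e = cong₂ combine (e fz) (funToFin-cong (e ∘ fs))

finToFun-injective : ∀ {d m} {a a′ : Fin (m ^ d)} → (∀ j → finToFun {m} {d} a j ≡ finToFun a′ j) → a ≡ a′
finToFun-injective {d} {m} {a} {a′} e =
  trans (sym (Fin.funToFin-finToFin {d} {m} a)) (trans (funToFin-cong {d} {m} e) (Fin.funToFin-finToFin {d} {m} a′))

module GridRoutes (d m r : ℕ) where
  open TokenGrid d m r

  gridRoute : Fin (m ^ d) → Fin (m ^ d) → Fin (suc d + d) → Token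
  gridRoute a b p = stop (finToFun a) (finToFun b) (splitAt (suc d) p)

  gridTag : Fin (m ^ d) → Fin (m ^ d) → Fin (suc d + d) → Fin (m ^ d)
  gridTag a b p = funToFin (stopTag (finToFun a) (finToFun b) (splitAt (suc d) p))

  gridRoute-paths : ∀ a b → PathIn (TokenAdj N (suc d)) (λ v → ∃ λ p → gridRoute a b p ≡ v)
                                   (X (finToFun a)) (X (finToFun b))
  gridRoute-paths a b = PathIn-map (λ { (s , refl) → join (suc d) d s ,
                                         cong (stop (finToFun a) (finToFun b)) (Fin.splitAt-join (suc d) d s) })
                                   (Route.route (finToFun a) (finToFun b))

  gridRoute-decode : ∀ a b a′ b′ p → gridRoute a b p ≡ gridRoute a′ b′ p → gridTag a b p ≡ gridTag a′ b′ p →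
    a ≡ a′ × b ≡ b′
  gridRoute-decode a b a′ b′ p e t with stop-decode _ _ _ _ (splitAt (suc d) p) e tags≗
    where
    tags≗ : ∀ j → stopTag (finToFun a) (finToFun b) (splitAt (suc d) p) j
                ≡ stopTag (finToFun a′) (finToFun b′) (splitAt (suc d) p) j
    tags≗ j = trans (sym (Fin.finToFun-funToFin _ j)) (trans (cong (λ c → finToFun c j) t) (Fin.finToFun-funToFin _ j))
  ... | a≗a′ , b≗b′ = finToFun-injective {d} {m} a≗a′ , finToFun-injective {d} {m} b≗b′

  grid-large-bag : (D : TreeDecomposition (TokenAdj N (suc d))) → 1 ≤ m →
    ∃ λ x → m ^ d * m ^ d ≤ 2 * (length (bag D x) * ((suc d + d) * m ^ d))
  grid-large-bag D m≥1 = large-bag-from-routing _≟-SizedSubset_ D (X ∘ finToFun)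
    (subst (_≤ m ^ d) (^-zeroˡ d) (^-monoˡ-≤ d m≥1)) gridRoute gridRoute-paths gridTag gridRoute-decode

-- The lower bound

2≤length : ∀ {A : Set} (xs : List A) {u v : A} → u ∈ xs → v ∈ xs → u ≢ v → 2 ≤ length xs
2≤length (x ∷ []) (here refl) (here refl) u≢v = ⊥-elim (u≢v refl)
2≤length (x ∷ y ∷ xs) _ _ _ = s≤s (s≤s z≤n)

edge⇒tw≥1 : ∀ {V : Set} {E : V → V → Set} {u v} → E u v → u ≢ v → TwBoundsBelow E 1 1
edge⇒tw≥1 {u = u} {v} uv u≢v D with edgeCover D u v uv
... | x , u∈ , v∈ = x , subst (_≤ 1 * (length (bag D x) ∸ 1)) (*-identityʳ 1)
                          (*-monoʳ-≤ 1 (∸-monoˡ-≤ 1 (2≤length (bag D x) u∈ v∈ u≢v)))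

tw-token-star-1-≥ : ∀ n → TwBoundsBelow (TokenAdj (suc n) 1) 1 (suc n ^ 0)
tw-token-star-1-≥ n = edge⇒tw≥1 centre–leaf centre≢leaf
  where
  centreSet leafSet : TokenV (suc n) 1
  centreSet = true ∷ false ∷ replicate n false , cong suc (∣⊥∣≡0 n)
  leafSet = false ∷ true ∷ replicate n false , cong suc (∣⊥∣≡0 n)
  centre–leaf : TokenAdj (suc n) 1 centreSet leafSet
  centre–leaf = TokenAdj-intro centreSet leafSet fz (fs fz) (inj₁ (refl , fs≢fz)) refl refl refl refl elsewhere
    where
    elsewhere : ∀ w → w ≢ fz → w ≢ fs fz → lookup (proj₁ centreSet) w ≡ lookup (proj₁ leafSet) w
    elsewhere fz w≢0 _ = ⊥-elim (w≢0 refl)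
    elsewhere (fs fz) _ w≢1 = ⊥-elim (w≢1 refl)
    elsewhere (fs (fs _)) _ _ = refl
  centre≢leaf : centreSet ≢ leafSet
  centre≢leaf ()

*-^-distrib : ∀ a b n → (a * b) ^ n ≡ a ^ n * b ^ n
*-^-distrib a b zero = refl
*-^-distrib a b (suc n) = trans (cong ((a * b) *_) (*-^-distrib a b n))
  (solve 4 (λ a b x y → (a :* b) :* (x :* y) := (a :* x) :* (b :* y)) refl a b (a ^ n) (b ^ n))
  where open +-*-Solver

≤2*pred : ∀ s → 2 ≤ s → s ≤ 2 * (s ∸ 1)
≤2*pred (suc t) (s≤s 1≤t) = begin
  suc t     ≡⟨ +-comm 1 t ⟩
  t + 1     ≤⟨ +-monoʳ-≤ t 1≤t ⟩
  t + t     ≡⟨ cong (t +_) (+-identityʳ t) ⟨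
  2 * t     ∎
  where open ≤-Reasoning

grid-width-arithmetic : ∀ d m r s l → 1 ≤ d → r < d → 2 * l < m →
  m ^ d * m ^ d ≤ 2 * (s * (l * m ^ d)) → (d * m + r) ^ d ≤ (2 * d) ^ d * (4 * l) * (s ∸ 1)
grid-width-arithmetic d m@(suc _) r s l 1≤d r<d 2l<m routing = begin
  (d * m + r) ^ d             ≤⟨ ^-monoˡ-≤ d n≤2dm ⟩
  ((2 * d) * m) ^ d           ≡⟨ *-^-distrib (2 * d) m d ⟩
  (2 * d) ^ d * q             ≤⟨ *-monoʳ-≤ ((2 * d) ^ d) q≤4l[s-1] ⟩
  (2 * d) ^ d * (4 * l * (s ∸ 1)) ≡⟨ *-assoc ((2 * d) ^ d) (4 * l) (s ∸ 1) ⟨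
  (2 * d) ^ d * (4 * l) * (s ∸ 1) ∎
  where
  open ≤-Reasoning
  open +-*-Solver
  q : ℕ
  q = m ^ d
  instance
    q≢0 : NonZero q
    q≢0 = m^n≢0 m d
  m≤q : m ≤ q
  m≤q = subst (_≤ q) (^-identityʳ m) (^-monoʳ-≤ m 1≤d)
  q≤2ls : q ≤ 2 * l * s
  q≤2ls = *-cancelʳ-≤ q (2 * l * s) q (subst (q * q ≤_)
    (solve 3 (λ s l q → con 2 :* (s :* (l :* q)) := con 2 :* l :* s :* q) refl s l q) routing)
  2≤s : 2 ≤ s
  2≤s with 2 ≤? s
  ... | yes 2≤s = 2≤s
  ... | no 2≰s = ⊥-elim (<⇒≱ 2l<m (begin
    m         ≤⟨ m≤q ⟩
    q         ≤⟨ q≤2ls ⟩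
    2 * l * s ≤⟨ *-monoʳ-≤ (2 * l) (s≤s⁻¹ (≰⇒> 2≰s)) ⟩
    2 * l * 1 ≡⟨ *-identityʳ (2 * l) ⟩
    2 * l     ∎))
  q≤4l[s-1] : q ≤ 4 * l * (s ∸ 1)
  q≤4l[s-1] = ≤-trans q≤2ls (≤-trans (*-monoʳ-≤ (2 * l) (≤2*pred s 2≤s))
    (≤-reflexive (solve 2 (λ l t → con 2 :* l :* (con 2 :* t) := con 4 :* l :* t) refl l (s ∸ 1))))
  n≤2dm : d * m + r ≤ (2 * d) * m
  n≤2dm = begin
    d * m + r     ≤⟨ +-monoʳ-≤ (d * m) (≤-trans (<⇒≤ r<d) (m≤m*n d m)) ⟩
    d * m + d * m ≡⟨ solve 2 (λ d m → d :* m :+ d :* m := con 2 :* d :* m) refl d m ⟩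
    (2 * d) * m   ∎

d*[n/d]+n%d≡n : ∀ n d .{{_ : NonZero d}} → d * (n / d) + n % d ≡ n
d*[n/d]+n%d≡n n d = trans (+-comm (d * (n / d)) (n % d))
  (trans (cong (n % d +_) (*-comm d (n / d))) (sym (m≡m%n+[m/n]*n n d)))

-- k = d + 1 tokens
module TokenStarLowerBound (d : ℕ) .{{_ : NonZero d}} where

  l : ℕ
  l = suc d + d

  c : ℕ
  c = (2 * d) ^ d * (4 * l)

  tw-grid-≥ : ∀ m r → 2 * l < m → r < d → TwBoundsBelow (TokenAdj (d * m + r) (suc d)) c ((d * m + r) ^ d)
  tw-grid-≥ m r 2l<m r<d D =
    let x , routing = GridRoutes.grid-large-bag d m r D (≤-trans (s≤s z≤n) 2l<m)
    in x , grid-width-arithmetic d m r (length (bag D x)) l (>-nonZero⁻¹ d) r<d 2l<m routing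

  tw-token-star-≥ : ∀ n → suc (2 * l) * d ≤ n → TwBoundsBelow (TokenAdj n (suc d)) c (n ^ d)
  tw-token-star-≥ n n≥ = subst (λ n → TwBoundsBelow (TokenAdj n (suc d)) c (n ^ d)) (d*[n/d]+n%d≡n n d)
    (tw-grid-≥ (n / d) (n % d) 2l<n/d (m%n<n n d))
    where
    2l<n/d : 2 * l < n / d
    2l<n/d = subst (_≤ n / d) (m*n/n≡m (suc (2 * l)) d) (/-monoˡ-≤ d n≥)

mainTheorem2 : ∀ (k : ℕ) → 1 ≤ k →
    ∃ λ (c : ℕ) → ∃ λ (C : ℕ) → ∃ λ (N : ℕ) →
    ∀ (n : ℕ) → N ≤ n →
    TwBoundsBelow (TokenAdj n k) c (n ^ (k ∸ 1))
    × TwAtMost (TokenAdj n k) (C * n ^ (k ∸ 1))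
mainTheorem2 (suc zero) _ =
  1 , 1 , 1 , λ { (suc n) _ → tw-token-star-1-≥ n , tw-token-star-≤ (suc n) 0 }
mainTheorem2 (suc (suc d′)) _ =
  c , 1 , suc (2 * l) * d , λ n n≥ → tw-token-star-≥ n n≥ , tw-token-star-≤ n d
  where
  d = suc d′
  open TokenStarLowerBound d
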